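{- Let $V=\{a^n : a,n \in \mathbb{N},\ n\ge 2\}$ be the set of pure powers. There is no infinite Hilbert cube contained in $V$; that is, there do not exist a non-negative integer $a_0$ and an infinite sequence of positive integers $a_1, a_2, \ldots$ such that $H(a_0; a_1, a_2, \ldots) \subset V$.
   Context: For an integer $a_0$ and an infinite sequence $a_1,a_2,\dots$, the infinite Hilbert cube is $H(a_0;a_1,a_2,\dots)=\{a_0+\sum_{i\ge 1}\varepsilon_i a_i : \varepsilon_i\in\{0,1\},\ \text{only finitely many } \varepsilon_i \ne 0\}$ when $a_0\neq 0$; when $a_0=0$ additionally the empty sum is excluded, i.e. one requires $0<\sum_i \varepsilon_i<\infty$. -}

module Defs where

open import Data.Nat using (ℕ; _+_; _^_; _≤_; _<_)
open import Data.List using (List; []; map)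
open import Data.Nat.ListAction using (sum)
open import Data.List.Relation.Unary.Unique.Propositional using (Unique)
open import Data.Product using (Σ; ∃; _×_)
open import Relation.Binary.PropositionalEquality using (_≡_)
open import Relation.Nullary using (¬_)

PurePower : ℕ → Set
PurePower x = ∃ λ a → ∃ λ n → (2 ≤ n) × (x ≡ a ^ n)

-- A choice of ε with finitely many ε_i ≠ 0 is encoded as a finite list S
-- of pairwise distinct indices (the i with ε_i = 1).  The sequence
-- a₁, a₂, … is encoded as a : ℕ → ℕ with a i standing for a_(i+1).
-- x ∈ H(a₀; a₁, a₂, …): x = a₀ + Σ_{i ∈ S} a_i, where S must be nonempty
-- if a₀ = 0.
InHilbertCube : ℕ → (ℕ → ℕ) → ℕ → Set
InHilbertCube a₀ a x =
  Σ (List ℕ) λ S → Unique S × ((a₀ ≡ 0) → ¬ (S ≡ [])) × (x ≡ a₀ + sum (map a S))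

HilbertCubeInPowers : ℕ → (ℕ → ℕ) → Set
HilbertCubeInPowers a₀ a = ∀ x → InHilbertCube a₀ a x → PurePower x

module Submission where

-- Let x = a₀ + a₁ + a₂ (≥ 2, an element of the cube), p a prime
-- divisor of x and M = pˣ.  Since the aᵢ are positive, pigeonhole on partial
-- sums mod M yields, above any index and of any size, blocks of consecutive
-- indices whose weight is divisible by M.  Stacking x such blocks above the
-- first two indices gives index sets with strictly increasing weights
-- σ 0 < σ 1 < … < σ x, all multiples of M; one more block, of weight C > σ x ^ x,
-- lies above all of them.  The numbers y t = x + C + σ t (t ≤ x) are in the
-- cube.  If y t = uˡ then l < x, for otherwise p ∣ u gives pˣ ∣ x.  So two of
-- the x + 1 numbers share an exponent l; two l-th powers differing by at most
-- σ x are below σ x ^ x < C, contradicting y t ≥ C.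

open import Defs
open import Data.Nat using (ℕ; zero; suc; _+_; _*_; _^_; _≤_; _<_; z≤n; s≤s; z<s; NonZero)
open import Data.Nat.Base using (>-nonZero; nonTrivial⇒n>1; s≤s⁻¹; _≤′_; ≤′-refl; ≤′-step)
open import Data.Nat.Properties
open import Data.Nat.Divisibility
  using (_∣_; ∣-refl; ∣-trans; *-pres-∣; *-monoʳ-∣; 1∣_; _∣0; ∣⇒≤; ∣m∣n⇒∣m+n; ∣m+n∣m⇒∣n; m∣m*n; n∣m*n; ∣1⇒≡1)
open import Data.Nat.DivMod using (_%_; _/_; m≡m%n+[m/n]*n; m%n<n)
open import Data.Nat.Primality using (Prime; euclidsLemma; ¬prime[1]; prime⇒nonTrivial; prime⇒nonZero)
open import Data.Nat.Primality.Factorisation using (factorise)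
open import Data.Nat.ListAction using (sum; product)
open import Data.Nat.ListAction.Properties using (sum-++)
open import Data.Fin using (Fin; toℕ; fromℕ<)
open import Data.Fin.Properties using (pigeonhole; toℕ<n; toℕ-fromℕ<)
open import Data.List using (List; []; _∷_; map; _++_)
open import Data.List.Properties using (map-++)
open import Data.List.Relation.Unary.All as All using (All; []; _∷_)
open import Data.List.Relation.Unary.All.Properties using () renaming (++⁺ to all-++)
open import Data.List.Relation.Unary.AllPairs using ([]; _∷_)
open import Data.List.Relation.Unary.Unique.Propositional using (Unique)
open import Data.List.Relation.Unary.Unique.Propositional.Properties using () renaming (++⁺ to unique-++)
open import Data.List.Relation.Binary.Disjoint.Propositional using (Disjoint)
open import Data.Product using (Σ; ∃; ∃₂; _×_; _,_; proj₁; proj₂)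
open import Data.Sum using (inj₁; inj₂)
open import Data.Empty using (⊥)
open import Function using (_∘_)
open import Relation.Nullary using (¬_; contradiction)
open import Relation.Binary.PropositionalEquality
  using (_≡_; refl; sym; trans; cong; subst; subst₂; module ≡-Reasoning)

prime-divisor : ∀ n → 2 ≤ n → ∃ λ p → Prime p × p ∣ n
prime-divisor n 2≤n with factorise n {{>-nonZero (<-trans z<s 2≤n)}}
... | record { factors = [] ; isFactorisation = n≡1 } =
  contradiction (subst (2 ≤_) n≡1 2≤n) λ { (s≤s ()) }
... | record { factors = p ∷ ps ; isFactorisation = n≡p*ps ; factorsPrime = prime-p ∷ _ } =
  p , prime-p , subst (p ∣_) (sym n≡p*ps) (m∣m*n (product ps))

n<m^n : ∀ m → 1 < m → ∀ n → n < m ^ n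
n<m^n m 1<m zero    = z<s
n<m^n m 1<m (suc n) = ≤-<-trans (n<m^n m 1<m n) (^-monoʳ-< m 1<m (n<1+n n))

prime∣^⇒∣ : ∀ {p} u l → Prime p → p ∣ u ^ l → p ∣ u
prime∣^⇒∣ u zero    prime-p p∣1 = contradiction (subst Prime (∣1⇒≡1 p∣1) prime-p) ¬prime[1]
prime∣^⇒∣ u (suc l) prime-p p∣u*u^l with euclidsLemma u (u ^ l) prime-p p∣u*u^l
... | inj₁ p∣u   = p∣u
... | inj₂ p∣u^l = prime∣^⇒∣ u l prime-p p∣u^l

^-monoˡ-∣ : ∀ {m n} l → m ∣ n → m ^ l ∣ n ^ l
^-monoˡ-∣ zero    m∣n = ∣-refl
^-monoˡ-∣ (suc l) m∣n = *-pres-∣ m∣n (^-monoˡ-∣ l m∣n)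

^-monoʳ-∣ : ∀ p {m n} → m ≤ n → p ^ m ∣ p ^ n
^-monoʳ-∣ p {n = n} z≤n = 1∣ (p ^ n)
^-monoʳ-∣ p (s≤s m≤n)   = *-monoʳ-∣ p (^-monoʳ-∣ p m≤n)

-- If a prime p divides x ≥ 1 and p^x divides r, then any way of writing
-- x + r as a power u^l has l < x: otherwise p ∣ u forces p^x ∣ u^l,
-- hence p^x ∣ x, which is impossible since x < p^x.
exponent-bound : ∀ {p x r u l} → Prime p → 1 ≤ x → p ∣ x → p ^ x ∣ r →
                 x + r ≡ u ^ l → l < x
exponent-bound {p} {x} {r} {u} {l} prime-p 1≤x p∣x p^x∣r x+r≡u^l = ≰⇒> λ x≤l →
  <⇒≱ (n<m^n p 1<p x) (∣⇒≤ {{>-nonZero 1≤x}} (p^x∣x x≤l))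
  where
  1<p : 1 < p
  1<p = nonTrivial⇒n>1 p {{prime⇒nonTrivial prime-p}}
  p∣r : p ∣ r
  p∣r = ∣-trans (∣-trans (m∣m*n 1) (^-monoʳ-∣ p 1≤x)) p^x∣r
  p∣u : p ∣ u
  p∣u = prime∣^⇒∣ u l prime-p (subst (p ∣_) x+r≡u^l (∣m∣n⇒∣m+n p∣x p∣r))
  p^x∣x : x ≤ l → p ^ x ∣ x
  p^x∣x x≤l = ∣m+n∣m⇒∣n (subst (p ^ x ∣_) (trans (sym x+r≡u^l) (+-comm x r)) p^x∣u^l) p^x∣r
    where
    p^x∣u^l : p ^ x ∣ u ^ l
    p^x∣u^l = ∣-trans (^-monoʳ-∣ p x≤l) (^-monoˡ-∣ l p∣u)

pow-gap : ∀ u l → 2 ≤ l → u ^ l + u < suc u ^ l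
pow-gap u 1 (s≤s ())
pow-gap u (suc (suc k)) _ = begin-strict
  u ^ (2 + k) + u                              <⟨ +-monoʳ-< (u ^ (2 + k)) (n<1+n u) ⟩
  u * u ^ (1 + k) + suc u                      ≤⟨ +-mono-≤ (*-monoʳ-≤ u (^-monoˡ-≤ (1 + k) (n≤1+n u)))
                                                           (m≤m*n (suc u) (suc u ^ k) {{m^n≢0 (suc u) k}}) ⟩
  u * suc u ^ (1 + k) + suc u * suc u ^ k      ≡⟨ +-comm (u * suc u ^ (1 + k)) (suc u ^ (1 + k)) ⟩
  suc u ^ (2 + k)                              ∎
  where open ≤-Reasoning

close-powers : ∀ {u w l s} → 2 ≤ l → u ^ l < w ^ l → w ^ l ≤ u ^ l + s → u < s
close-powers {u} {w} {l} {s} 2≤l u^l<w^l w^l≤u^l+s = ≰⇒> λ s≤u →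
  <⇒≱ (begin-strict
    u ^ l + s   ≤⟨ +-monoʳ-≤ (u ^ l) s≤u ⟩
    u ^ l + u   <⟨ pow-gap u l 2≤l ⟩
    suc u ^ l   ≤⟨ ^-monoˡ-≤ l u<w ⟩
    w ^ l       ∎) w^l≤u^l+s
  where
  open ≤-Reasoning
  u<w : u < w
  u<w = ≰⇒> λ w≤u → <⇒≱ u^l<w^l (^-monoˡ-≤ l w≤u)

close-powers-small : ∀ {u w l s x} → 2 ≤ l → l ≤ x →
                     u ^ l < w ^ l → w ^ l ≤ u ^ l + s → u ^ l < s ^ x
close-powers-small {u} {w} {l} {s} {x} 2≤l l≤x u^l<w^l w^l≤u^l+s = begin-strict
  u ^ l   <⟨ ^-monoˡ-< l {{>-nonZero (<-trans z<s 2≤l)}} u<s ⟩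
  s ^ l   ≤⟨ ^-monoʳ-≤ s {{>-nonZero (≤-<-trans z≤n u<s)}} l≤x ⟩
  s ^ x   ∎
  where
  open ≤-Reasoning
  u<s : u < s
  u<s = close-powers 2≤l u^l<w^l w^l≤u^l+s

step⇒mono : (f : ℕ → ℕ) → (∀ t → f t ≤ f (suc t)) → ∀ {t t'} → t ≤ t' → f t ≤ f t'
step⇒mono f step t≤t' = go (≤⇒≤′ t≤t')
  where
  go : ∀ {t t'} → t ≤′ t' → f t ≤ f t'
  go ≤′-refl       = ≤-refl
  go (≤′-step t≤t') = ≤-trans (go t≤t') (step _)

step⇒strict : (f : ℕ → ℕ) → (∀ t → f t < f (suc t)) → ∀ {t t'} → t < t' → f t < f t'
step⇒strict f step t<t' = <-≤-trans (step _) (step⇒mono f (λ t → <⇒≤ (step t)) t<t')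

pigeonhole-ℕ : ∀ m (f : Fin (suc m) → ℕ) → (∀ i → f i < m) →
               ∃₂ λ i j → toℕ i < toℕ j × f i ≡ f j
pigeonhole-ℕ m f f<m =
  let (i , j , i<j , same) = pigeonhole (n<1+n m) (λ i → fromℕ< (f<m i))
  in i , j , i<j , (begin
       f i                    ≡⟨ toℕ-fromℕ< (f<m i) ⟨
       toℕ (fromℕ< (f<m i))   ≡⟨ cong toℕ same ⟩
       toℕ (fromℕ< (f<m j))   ≡⟨ toℕ-fromℕ< (f<m j) ⟩
       f j                    ∎)
  where open ≡-Reasoning

-- Then the x + 1 numbers y t = x + C + σ t (t ≤ x)
-- are not all pure powers: each exponent is below x (exponent-bound), so two
-- of them share an exponent l (pigeonhole), and two l-th powers this close
-- together are smaller than σ x ^ x (close-powers-small), whereas y t ≥ C.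
ladder-not-powers :
  ∀ {p} x → Prime p → 1 ≤ x → p ∣ x →
  (σ : ℕ → ℕ) → (∀ t → σ t < σ (suc t)) → (∀ t → p ^ x ∣ σ t) →
  (C : ℕ) → p ^ x ∣ C → σ x ^ x < C →
  ((t : ℕ) → t ≤ x → PurePower (x + C + σ t)) → ⊥
ladder-not-powers {p} x prime-p 1≤x p∣x σ σ-step p^x∣σ C p^x∣C C-large powers =
  let (i , j , i<j , same) = pigeonhole-ℕ x exponent exponent<x
      (u , l , 2≤l , yi≡u^l)  = power i
      (w , _ , _   , yj≡w^l') = power j
  in same-exponent i<j (index≤x j) 2≤l (exponent<x i) yi≡u^l
       (subst (λ k → y (toℕ j) ≡ w ^ k) (sym same) yj≡w^l')
  where
  y : ℕ → ℕ
  y t = x + C + σ t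

  index≤x : (i : Fin (suc x)) → toℕ i ≤ x
  index≤x i = s≤s⁻¹ (toℕ<n i)

  power : (i : Fin (suc x)) → PurePower (y (toℕ i))
  power i = powers (toℕ i) (index≤x i)

  exponent : Fin (suc x) → ℕ
  exponent i = proj₁ (proj₂ (power i))

  exponent<x : ∀ i → exponent i < x
  exponent<x i = let (_ , _ , _ , yi≡u^l) = power i in
    exponent-bound prime-p 1≤x p∣x (∣m∣n⇒∣m+n p^x∣C (p^x∣σ (toℕ i))) (trans (sym (+-assoc x C _)) yi≡u^l)

  same-exponent : ∀ {i j u w l} → i < j → j ≤ x → 2 ≤ l → l < x →
                  y i ≡ u ^ l → y j ≡ w ^ l → ⊥
  same-exponent {i} {j} {u} {w} {l} i<j j≤x 2≤l l<x yi≡u^l yj≡w^l =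
    <-irrefl refl (begin-strict
      C           ≤⟨ ≤-trans (m≤n+m C x) (m≤m+n (x + C) (σ i)) ⟩
      y i         ≡⟨ yi≡u^l ⟩
      u ^ l       <⟨ close-powers-small 2≤l (<⇒≤ l<x) u^l<w^l w^l≤u^l+σx ⟩
      σ x ^ x     <⟨ C-large ⟩
      C           ∎)
    where
    open ≤-Reasoning
    σj≤σi+σx : σ j ≤ σ i + σ x
    σj≤σi+σx = ≤-trans (step⇒mono σ (λ t → <⇒≤ (σ-step t)) j≤x) (m≤n+m (σ x) (σ i))
    u^l<w^l : u ^ l < w ^ l
    u^l<w^l = subst₂ _<_ yi≡u^l yj≡w^l (+-monoʳ-< (x + C) (step⇒strict σ σ-step i<j))
    w^l≤u^l+σx : w ^ l ≤ u ^ l + σ x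
    w^l≤u^l+σx = subst₂ _≤_ yj≡w^l (cong (_+ σ x) yi≡u^l)
                   (≤-trans (+-monoʳ-≤ (x + C) σj≤σi+σx) (≤-reflexive (sym (+-assoc (x + C) (σ i) (σ x)))))

%-cong⇒∣ : ∀ M .{{_ : NonZero M}} m n → m % M ≡ (m + n) % M → M ∣ n
%-cong⇒∣ M m n same = ∣m+n∣m⇒∣n M∣[m/M]*M+n (n∣m*n (m / M))
  where
  open ≡-Reasoning
  residue-cancelled : m % M + ((m / M) * M + n) ≡ m % M + ((m + n) / M) * M
  residue-cancelled = begin
    m % M + ((m / M) * M + n)        ≡⟨ +-assoc (m % M) ((m / M) * M) n ⟨
    m % M + (m / M) * M + n          ≡⟨ cong (_+ n) (m≡m%n+[m/n]*n m M) ⟨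
    m + n                            ≡⟨ m≡m%n+[m/n]*n (m + n) M ⟩
    (m + n) % M + ((m + n) / M) * M  ≡⟨ cong (_+ ((m + n) / M) * M) same ⟨
    m % M + ((m + n) / M) * M        ∎
  M∣[m/M]*M+n : M ∣ (m / M) * M + n
  M∣[m/M]*M+n = subst (M ∣_) (sym (+-cancelˡ-≡ (m % M) _ _ residue-cancelled)) (n∣m*n ((m + n) / M))

separated⇒disjoint : ∀ {b} {S T : List ℕ} → All (_< b) S → All (b ≤_) T → Disjoint S T
separated⇒disjoint S<b b≤T (v∈S , v∈T) = <⇒≱ (All.lookup S<b v∈S) (All.lookup b≤T v∈T)

module IndexSets (a : ℕ → ℕ) (pos : ∀ i → 0 < a i) where

  weight : List ℕ → ℕ
  weight S = sum (map a S)

  weight-++ : ∀ S T → weight (S ++ T) ≡ weight S + weight T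
  weight-++ S T = trans (cong sum (map-++ a S T)) (sum-++ (map a S) (map a T))

  interval : ℕ → ℕ → List ℕ
  interval l zero    = []
  interval l (suc k) = l ∷ interval (suc l) k

  interval-split : ∀ l m n → interval l (m + n) ≡ interval l m ++ interval (l + m) n
  interval-split l zero    n = cong (λ l' → interval l' n) (sym (+-identityʳ l))
  interval-split l (suc m) n = cong (l ∷_) (trans (interval-split (suc l) m n)
                                 (cong (λ l' → interval (suc l) m ++ interval l' n) (sym (+-suc l m))))

  length≤weight : ∀ l k → k ≤ weight (interval l k)
  length≤weight l zero    = z≤n
  length≤weight l (suc k) = +-mono-≤ (pos l) (length≤weight (suc l) k)

  interval-lower : ∀ l k → All (l ≤_) (interval l k)
  interval-lower l zero    = []
  interval-lower l (suc k) = ≤-refl ∷ All.map (≤-trans (n≤1+n l)) (interval-lower (suc l) k)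

  interval-upper : ∀ l k → All (_< l + k) (interval l k)
  interval-upper l zero    = []
  interval-upper l (suc k) = subst (λ e → All (_< e) (l ∷ interval (suc l) k)) (sym (+-suc l k))
                               (s≤s (m≤m+n l k) ∷ interval-upper (suc l) k)

  interval-unique : ∀ l k → Unique (interval l k)
  interval-unique l zero    = []
  interval-unique l (suc k) = All.map (λ l<i l≡i → <-irrefl l≡i l<i) (interval-lower (suc l) k)
                              ∷ interval-unique (suc l) k

  record Block (M s N : ℕ) : Set where
    field
      first size : ℕ
      above     : s ≤ first
      heavy     : N < weight (interval first size)
      divisible : M ∣ weight (interval first size)

  -- Among the M + 1 weights W i of the intervals
  -- [s, s + i (N + 1)), i ≤ M, two are congruent mod M; the difference of
  -- the intervals is a block of length at least N + 1.
  divisible-block : ∀ M .{{_ : NonZero M}} s N → Block M s N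
  divisible-block M s N =
    let (i , j , i<j , same) = pigeonhole-ℕ M (λ i → W (toℕ i) % M) (λ i → m%n<n (W (toℕ i)) M)
    in block-between (toℕ i) (toℕ j) i<j same
    where
    W : ℕ → ℕ
    W i = weight (interval s (i * suc N))

    block-between : ∀ i j → i < j → W i % M ≡ W j % M → Block M s N
    block-between i j i<j same with m≤n⇒∃[o]m+o≡n i<j
    ... | k , refl = record
      { first     = s + i * suc N
      ; size      = suc k * suc N
      ; above     = m≤m+n s (i * suc N)
      ; heavy     = ≤-trans (m≤m+n (suc N) (k * suc N)) (length≤weight _ _)
      ; divisible = %-cong⇒∣ M (W i) _ (trans same (cong (_% M) W-split))
      }
      where
      W-split : W (suc i + k) ≡ W i + weight (interval (s + i * suc N) (suc k * suc N))
      W-split = begin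
        weight (interval s ((suc i + k) * suc N))                  ≡⟨ cong (λ n → weight (interval s (n * suc N))) (+-suc i k) ⟨
        weight (interval s ((i + suc k) * suc N))                  ≡⟨ cong (weight ∘ interval s) (*-distribʳ-+ (suc N) i (suc k)) ⟩
        weight (interval s (i * suc N + suc k * suc N))            ≡⟨ cong weight (interval-split s (i * suc N) (suc k * suc N)) ⟩
        weight (interval s (i * suc N) ++ interval (s + i * suc N) (suc k * suc N))
                                                                   ≡⟨ weight-++ (interval s (i * suc N)) _ ⟩
        W i + weight (interval (s + i * suc N) (suc k * suc N))    ∎
        where open ≡-Reasoning

  -- The ladder for a modulus M: stage t is a set of distinct indices in
  -- [2, bound) whose weight σ t is a multiple of M; each stage adds a fresh
  -- block above the previous bound, so σ increases strictly.
  module Ladder (M : ℕ) .{{_ : NonZero M}} where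

    record Stage : Set where
      field
        chosen      : List ℕ
        bound       : ℕ
        2≤bound     : 2 ≤ bound
        unique      : Unique chosen
        above-2     : All (2 ≤_) chosen
        below-bound : All (_< bound) chosen
        divisible   : M ∣ weight chosen

    next : Stage → Stage
    next S = record
      { chosen      = chosen ++ interval first size
      ; bound       = first + size
      ; 2≤bound     = ≤-trans 2≤bound bound≤end
      ; unique      = unique-++ unique (interval-unique first size)
                        (separated⇒disjoint (All.map (λ i<b → <-≤-trans i<b above) below-bound)
                                            (interval-lower first size))
      ; above-2     = all-++ above-2
                        (All.map (λ first≤i → ≤-trans 2≤bound (≤-trans above first≤i)) (interval-lower first size))
      ; below-bound = all-++ (All.map (λ i<b → <-≤-trans i<b bound≤end) below-bound) (interval-upper first size)
      ; divisible   = subst (M ∣_) (sym (weight-++ chosen _)) (∣m∣n⇒∣m+n divisible (Block.divisible block))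
      }
      where
      open Stage S
      block : Block M bound 0
      block = divisible-block M bound 0
      open Block block using (first; size; above)
      bound≤end : bound ≤ first + size
      bound≤end = ≤-trans above (m≤m+n first size)

    -- Stage 0 chooses nothing; its bound 2 keeps the first two indices free.
    initial : Stage
    initial = record
      { chosen = [] ; bound = 2 ; 2≤bound = ≤-refl ; unique = []
      ; above-2 = [] ; below-bound = [] ; divisible = M ∣0 }

    stage : ℕ → Stage
    stage zero    = initial
    stage (suc t) = next (stage t)

    bound : ℕ → ℕ
    bound t = Stage.bound (stage t)

    σ : ℕ → ℕ
    σ t = weight (Stage.chosen (stage t))

    σ-divisible : ∀ t → M ∣ σ t
    σ-divisible t = Stage.divisible (stage t)

    σ-step : ∀ t → σ t < σ (suc t)
    σ-step t = begin-strict
      σ t                                      <⟨ m<m+n (σ t) (Block.heavy block) ⟩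
      σ t + weight (interval first size)       ≡⟨ weight-++ (Stage.chosen (stage t)) _ ⟨
      σ (suc t)                                ∎
      where
      open ≤-Reasoning
      block : Block M (bound t) 0
      block = divisible-block M (bound t) 0
      open Block block using (first; size)

    -- Later stages have larger bounds, so every stage lies below the top block.
    bound-mono : ∀ {t t'} → t ≤ t' → bound t ≤ bound t'
    bound-mono = step⇒mono bound λ t →
      let open Block (divisible-block M (bound t) 0) in ≤-trans above (m≤m+n first size)

    module Top (n N : ℕ) where

      top : Block M (bound n) N
      top = divisible-block M (bound n) N

      open Block top using (first; size; above)

      C : ℕ
      C = weight (interval first size)

      cube-indices : ℕ → List ℕ
      cube-indices t = interval 0 2 ++ (Stage.chosen (stage t) ++ interval first size)

      cube-indices-unique : ∀ t → t ≤ n → Unique (cube-indices t)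
      cube-indices-unique t t≤n =
        unique-++ (interval-unique 0 2)
          (unique-++ unique (interval-unique first size) (separated⇒disjoint chosen<first (interval-lower first size)))
          (separated⇒disjoint (interval-upper 0 2) rest≥2)
        where
        open Stage (stage t)
        chosen<first : All (_< first) chosen
        chosen<first = All.map (λ i<b → <-≤-trans i<b (≤-trans (bound-mono t≤n) above)) below-bound
        rest≥2 : All (2 ≤_) (chosen ++ interval first size)
        rest≥2 = all-++ above-2
                   (All.map (≤-trans (≤-trans (Stage.2≤bound (stage n)) above)) (interval-lower first size))

      in-cube : ∀ a₀ t → t ≤ n → InHilbertCube a₀ a (a₀ + weight (interval 0 2) + C + σ t)
      in-cube a₀ t t≤n = cube-indices t , cube-indices-unique t t≤n , (λ _ ()) , (begin
        a₀ + w + C + σ t                        ≡⟨ +-assoc (a₀ + w) C (σ t) ⟩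
        a₀ + w + (C + σ t)                      ≡⟨ cong (a₀ + w +_) (+-comm C (σ t)) ⟩
        a₀ + w + (σ t + C)                      ≡⟨ +-assoc a₀ w (σ t + C) ⟩
        a₀ + (w + (σ t + C))                    ≡⟨ cong (λ r → a₀ + (w + r)) (weight-++ (Stage.chosen (stage t)) _) ⟨
        a₀ + (w + weight rest)                  ≡⟨ cong (a₀ +_) (weight-++ (interval 0 2) rest) ⟨
        a₀ + weight (cube-indices t)            ∎)
        where
        open ≡-Reasoning
        w : ℕ
        w = weight (interval 0 2)
        rest : List ℕ
        rest = Stage.chosen (stage t) ++ interval first size

theorem5 : ¬ (Σ ℕ λ a₀ → Σ (ℕ → ℕ) λ a → ((i : ℕ) → 0 < a i) × HilbertCubeInPowers a₀ a)
theorem5 (a₀ , a , pos , cube⊆V) = contradiction-for (prime-divisor x 2≤x)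
  where
  open IndexSets a pos

  x : ℕ
  x = a₀ + weight (interval 0 2)

  2≤x : 2 ≤ x
  2≤x = ≤-trans (length≤weight 0 2) (m≤n+m _ a₀)

  contradiction-for : (∃ λ p → Prime p × p ∣ x) → ⊥
  contradiction-for (p , prime-p , p∣x) =
    ladder-not-powers x prime-p (<⇒≤ 2≤x) p∣x σ σ-step σ-divisible
      C (Block.divisible top) (Block.heavy top) (λ t t≤x → cube⊆V _ (in-cube a₀ t t≤x))
    where
    open Ladder (p ^ x) {{m^n≢0 p x {{prime⇒nonZero prime-p}}}}
    open Top x (σ x ^ x)
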